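{- Let $S$ be a separator of a chordal graph $G$. For any vertex $v\notin S$, the maximal cliques of $G$ containing $v$ induce a connected subgraph of $C(G)-S$. For any two distinct vertices $u,v\notin S$, there is no path in $C(G)-S$ from a maximal clique containing $u$ to a maximal clique containing $v$ if and only if $S$ is a $u$-$v$ separator.
   Context: A graph is chordal if it has no induced cycle on four or more vertices. A set $S$ is a $u$-$v$ separator if $u,v\notin S$ and $u,v$ lie in different components of $G-S$; $S$ is a separator if it is a $u$-$v$ separator for some $u,v$; a minimal $u$-$v$ separator is an inclusion-minimal one. The weighted clique graph $C(G)$ has the maximal cliques of $G$ as vertices; $K_i,K_j$ are adjacent iff $K_i\cap K_j$ is a minimal $x$-$y$ separator for all $x\in K_i\setminus K_j$, $y\in K_j\setminus K_i$; the edge has label $K_i\cap K_j$ and weight $|K_i\cap K_j|$. For $S\subseteq V(G)$, $C(G)-S$ denotes the graph obtained from $C(G)$ by deleting all edges whose labels are subsets of $S$ (all cliques are kept). -}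

module Defs where

open import Data.Nat using (ℕ; suc; _+_; _%_)
open import Data.Fin using (Fin; toℕ)
open import Data.Fin.Subset using (Subset; _∈_; _∉_; _⊆_; _∩_)
open import Data.Product using (_×_; ∃; ∃-syntax; Σ-syntax)
open import Data.Sum using (_⊎_)
open import Relation.Nullary using (¬_; Dec)
open import Relation.Binary.PropositionalEquality using (_≡_; _≢_)
open import Relation.Binary.Construct.Closure.ReflexiveTransitive using (Star)
open import Function using (_⇔_)
open import Function.Definitions using (Injective)

record Graph (n : ℕ) : Set₁ where
  field
    E      : Fin n → Fin n → Set
    sym    : ∀ {x y} → E x y → E y x
    irrefl : ∀ {x} → ¬ E x x
    dec    : ∀ x y → Dec (E x y)
open Graph public

module _ {n : ℕ} (G : Graph n) where

  CycAdj : ∀ {k} → Fin (suc k) → Fin (suc k) → Set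
  CycAdj {k} i j = (toℕ j ≡ suc (toℕ i) % suc k) ⊎ (toℕ i ≡ suc (toℕ j) % suc k)

  InducedCycle : (m : ℕ) → (Fin (4 + m) → Fin n) → Set
  InducedCycle m c =
    Injective _≡_ _≡_ c × (∀ i j → E G (c i) (c j) ⇔ CycAdj i j)

  Chordal : Set
  Chordal = ∀ m (c : Fin (4 + m) → Fin n) → ¬ InducedCycle m c

  ReachAvoid : Subset n → Fin n → Fin n → Set
  ReachAvoid S x y =
    x ∉ S × Star (λ a b → E G a b × a ∉ S × b ∉ S) x y

  SepUV : Fin n → Fin n → Subset n → Set
  SepUV u v S = u ∉ S × v ∉ S × ¬ ReachAvoid S u v

  IsSeparator : Subset n → Set
  IsSeparator S = ∃[ u ] ∃[ v ] SepUV u v S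

  MinSepUV : Fin n → Fin n → Subset n → Set
  MinSepUV u v S = SepUV u v S × (∀ T → T ⊆ S → SepUV u v T → S ⊆ T)

  IsClique : Subset n → Set
  IsClique K = ∀ {x y} → x ∈ K → y ∈ K → x ≢ y → E G x y

  IsMaxClique : Subset n → Set
  IsMaxClique K = IsClique K × (∀ K′ → IsClique K′ → K ⊆ K′ → K′ ⊆ K)

  CAdj : Subset n → Subset n → Set
  CAdj K₁ K₂ =
    IsMaxClique K₁ × IsMaxClique K₂ × K₁ ≢ K₂ ×
    (∀ x y → x ∈ K₁ → x ∉ K₂ → y ∈ K₂ → y ∉ K₁ → MinSepUV x y (K₁ ∩ K₂))

  -- adjacency in C(G) - S : edges whose label K₁ ∩ K₂ is a subset of S are deleted
  CAdjMinus : Subset n → Subset n → Subset n → Set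
  CAdjMinus S K₁ K₂ = CAdj K₁ K₂ × ¬ (K₁ ∩ K₂ ⊆ S)

  CPath : Subset n → Subset n → Subset n → Set
  CPath S K₁ K₂ = IsMaxClique K₁ × Star (CAdjMinus S) K₁ K₂

  CPathThrough : Subset n → Fin n → Subset n → Subset n → Set
  CPathThrough S v K₁ K₂ =
    IsMaxClique K₁ × v ∈ K₁ ×
    Star (λ A B → CAdjMinus S A B × v ∈ A × v ∈ B) K₁ K₂

module Submission where

-- Part one (the maximal cliques through v ∉ S are connected in C(G) - S) is proved by
-- well-founded induction on K₁ ∩ K₂ along ⊃.  For distinct maximal cliques K₁, K₂ with
-- T = K₁ ∩ K₂ there is a dichotomy: either T is a minimal x–y separator for all
-- x ∈ K₁ ∖ K₂, y ∈ K₂ ∖ K₁ (so K₁K₂ is an edge of C(G), kept in C(G) - S since v ∈ T),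
-- or some such x, y are connected in G - T.  In the latter case chordality lets us reroute
-- the x–y walk through vertices adjacent to all of T (the neighbourhood lemma: closing an
-- induced detour around a vertex s would create an induced cycle of length ≥ 4); the
-- edges of that walk, together with T, lie in maximal cliques forming a chain from K₁
-- to K₂ whose consecutive intersections strictly contain T, and induction applies.
--
-- Part two follows: a path in C(G) - S between cliques through u and v gives a u–v walk in
-- G - S (each kept label has a vertex outside S), and a u–v walk in G - S gives such a path
-- (each edge lies in a maximal clique, reached by part one).

open import Defs
open import Data.Nat using (ℕ; zero; suc; _<_; z≤n; s≤s; _%_)
import Data.Nat.Properties as ℕ
open import Data.Nat.DivMod using (m<n⇒m%n≡m; n%n≡0)
open import Data.Fin using (Fin; zero; suc; toℕ; fromℕ; _≟_)
open import Data.Fin.Properties using (any?; all?; toℕ<n; toℕ-fromℕ; toℕ-injective)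
open import Data.Fin.Subset using (Subset; _∈_; _∉_; _⊆_; _⊃_; _∪_; _∩_; ⁅_⁆)
open import Data.Fin.Subset.Properties
  using (_∈?_; x∈p∪q⁺; x∈p∪q⁻; x∈⁅x⁆; x∈⁅y⁆⇒x≡y; x∈p∩q⁺; p∩q⊆p; p∩q⊆q)
open import Data.Fin.Subset.Induction using (⊃-wellFounded)
import Data.Bool as Bool
open import Data.Vec.Properties using (≡-dec)
open import Data.Unit using (⊤; tt)
open import Data.Empty using (⊥; ⊥-elim)
open import Data.Product using (_×_; _,_; proj₁; proj₂; ∃-syntax)
open import Data.Sum as Sum using (_⊎_; inj₁; inj₂)
open import Data.List using (List; []; _∷_; length; lookup; filter; allFin)
open import Data.List.Relation.Unary.All as All using (All; []; _∷_)
open import Data.List.Relation.Unary.Any as Any using (Any; here; there)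
open import Data.List.Relation.Unary.All.Properties using (¬Any⇒All¬)
open import Data.List.Membership.Propositional using () renaming (_∈_ to _∈ₗ_)
open import Data.List.Membership.Propositional.Properties using (∈-lookup; ∈-allFin; ∈-filter⁺; ∈-filter⁻)
open import Function using (id; _∘_; _⇔_; mk⇔; Equivalence)
open import Induction.WellFounded using (Acc; acc)
open import Relation.Nullary using (¬_; Dec; yes; no)
open import Relation.Nullary.Decidable using (_×-dec_; _⊎-dec_; _→-dec_; ¬?; decidable-stable)
open import Relation.Binary.Definitions using (DecidableEquality)
open import Relation.Binary.PropositionalEquality as ≡ using (_≡_; _≢_; refl)
open ≡.≡-Reasoning
open import Relation.Binary.Construct.Closure.ReflexiveTransitive as Star using (Star; ε; _◅_; _◅◅_)

grow : ∀ {n} {A : Subset n} {b} → b ∉ A → (A ∪ ⁅ b ⁆) ⊃ A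
grow {b = b} b∉A = (λ a∈A → x∈p∪q⁺ (inj₁ a∈A)) , b , x∈p∪q⁺ (inj₂ (x∈⁅x⁆ b)) , b∉A

module Reachability {n : ℕ} {R : Fin n → Fin n → Set} (R? : ∀ a b → Dec (R a b)) where

  Closed : Subset n → Set
  Closed A = ∀ {a b} → a ∈ A → R a b → b ∈ A

  stays-in-closed : ∀ {A a b} → Closed A → a ∈ A → Star R a b → b ∈ A
  stays-in-closed closed a∈A ε = a∈A
  stays-in-closed closed a∈A (r ◅ rs) = stays-in-closed closed (closed a∈A r) rs

  closed-or-exit : ∀ A → Closed A ⊎ ∃[ a ] ∃[ b ] (a ∈ A × R a b × b ∉ A)
  closed-or-exit A with any? (λ a → any? λ b → (a ∈? A) ×-dec R? a b ×-dec ¬? (b ∈? A))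
  ... | yes (a , b , exit) = inj₂ (a , b , exit)
  ... | no none = inj₁ λ {a} {b} a∈A r → decidable-stable (b ∈? A) λ b∉A → none (a , b , a∈A , r , b∉A)

  -- Grow a set of vertices reachable from x, one exit at a time, until it is closed;
  -- this terminates because ⊃ is well-founded on subsets of Fin n.
  search : ∀ {x} y A → Acc _⊃_ A → x ∈ A → (∀ {a} → a ∈ A → Star R x a) → Dec (Star R x y)
  search y A (acc larger) x∈A reach with closed-or-exit A
  ... | inj₁ closed with y ∈? A
  ...   | yes y∈A = yes (reach y∈A)
  ...   | no y∉A = no λ x⇝y → y∉A (stays-in-closed closed x∈A x⇝y)
  search {x} y A (acc larger) x∈A reach | inj₂ (a , b , a∈A , r , b∉A) =
    search y (A ∪ ⁅ b ⁆) (larger (grow b∉A)) (x∈p∪q⁺ (inj₁ x∈A)) reach′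
    where
    reach′ : ∀ {c} → c ∈ A ∪ ⁅ b ⁆ → Star R x c
    reach′ c∈ with x∈p∪q⁻ A ⁅ b ⁆ c∈
    ... | inj₁ c∈A = reach c∈A
    ... | inj₂ c∈b with x∈⁅y⁆⇒x≡y b c∈b
    ...   | refl = reach a∈A ◅◅ (r ◅ ε)

  star? : ∀ x y → Dec (Star R x y)
  star? x y = search y ⁅ x ⁆ (⊃-wellFounded _) (x∈⁅x⁆ x) from-x
    where
    from-x : ∀ {a} → a ∈ ⁅ x ⁆ → Star R x a
    from-x a∈ with x∈⁅y⁆⇒x≡y x a∈
    ... | refl = ε

_≟ₛ_ : ∀ {n} → DecidableEquality (Subset n)
_≟ₛ_ = ≡-dec Bool._≟_

⊈-witness : ∀ {n} {A B : Subset n} → ¬ (A ⊆ B) → ∃[ x ] (x ∈ A × x ∉ B)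
⊈-witness {A = A} {B} A⊈B with any? (λ x → (x ∈? A) ×-dec ¬? (x ∈? B))
... | yes witness = witness
... | no none = ⊥-elim (A⊈B λ {x} x∈A → decidable-stable (x ∈? B) λ x∉B → none (x , x∈A , x∉B))

module Cliques {n : ℕ} (G : Graph n) where

  -- Walks through vertices satisfying P; Walk (_∉ S) is the relation used by ReachAvoid G S.
  Walk : (Fin n → Set) → Fin n → Fin n → Set
  Walk P = Star (λ p q → E G p q × P p × P q)

  clique-walk : ∀ {S K a b} → IsClique G K → a ∈ K → b ∈ K → a ∉ S → b ∉ S → Walk (_∉ S) a b
  clique-walk {a = a} {b} K-clique a∈K b∈K a∉S b∉S with a ≟ b
  ... | yes refl = ε
  ... | no a≢b = (K-clique a∈K b∈K a≢b , a∉S , b∉S) ◅ ε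

  subset-clique : ∀ {A B} → IsClique G B → A ⊆ B → IsClique G A
  subset-clique B-clique A⊆B x∈A y∈A = B-clique (A⊆B x∈A) (A⊆B y∈A)

  singleton-clique : ∀ a → IsClique G ⁅ a ⁆
  singleton-clique a x∈ y∈ x≢y = ⊥-elim (x≢y (≡.trans (x∈⁅y⁆⇒x≡y a x∈) (≡.sym (x∈⁅y⁆⇒x≡y a y∈))))

  insert-clique : ∀ {K w} → IsClique G K → (∀ {x} → x ∈ K → x ≢ w → E G x w) → IsClique G (K ∪ ⁅ w ⁆)
  insert-clique {K} {w} K-clique K~w {x} {y} x∈ y∈ x≢y with x∈p∪q⁻ K ⁅ w ⁆ x∈ | x∈p∪q⁻ K ⁅ w ⁆ y∈
  ... | inj₁ x∈K | inj₁ y∈K = K-clique x∈K y∈K x≢y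
  ... | inj₁ x∈K | inj₂ y∈w rewrite x∈⁅y⁆⇒x≡y w y∈w = K~w x∈K x≢y
  ... | inj₂ x∈w | inj₁ y∈K rewrite x∈⁅y⁆⇒x≡y w x∈w = sym G (K~w y∈K (x≢y ∘ ≡.sym))
  ... | inj₂ x∈w | inj₂ y∈w = singleton-clique w x∈w y∈w x≢y

  Extends : Subset n → Fin n → Set
  Extends K w = w ∉ K × (∀ x → x ∈ K → E G x w)

  unextendable⇒maximal : ∀ {K} → IsClique G K → (∀ w → ¬ Extends K w) → IsMaxClique G K
  unextendable⇒maximal {K} K-clique none = K-clique , maximal
    where
    maximal : ∀ K′ → IsClique G K′ → K ⊆ K′ → K′ ⊆ K
    maximal K′ K′-clique K⊆K′ {w} w∈K′ = decidable-stable (w ∈? K) λ w∉K →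
      none w (w∉K , λ x x∈K → K′-clique (K⊆K′ x∈K) w∈K′ λ x≡w → w∉K (≡.subst (_∈ K) x≡w x∈K))

  -- Every clique lies in a maximal clique: keep adding extensions (⊃ is well-founded).
  maximal-extension : ∀ {K} → IsClique G K → ∃[ M ] (IsMaxClique G M × K ⊆ M)
  maximal-extension {K} = extend K (⊃-wellFounded K)
    where
    extend : ∀ K → Acc _⊃_ K → IsClique G K → ∃[ M ] (IsMaxClique G M × K ⊆ M)
    extend K (acc larger) K-clique with any? (λ w → ¬? (w ∈? K) ×-dec all? λ x → (x ∈? K) →-dec dec G x w)
    ... | no none = K , unextendable⇒maximal K-clique (λ w ext → none (w , ext)) , id
    ... | yes (w , w∉K , K~w) with extend (K ∪ ⁅ w ⁆) (larger (grow w∉K)) (insert-clique K-clique λ x∈K _ → K~w _ x∈K)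
    ...   | M , M-max , K+w⊆M = M , M-max , λ x∈K → K+w⊆M (x∈p∪q⁺ (inj₁ x∈K))

  edge-in-maximal-clique : ∀ {a b} → E G a b → ∃[ M ] (IsMaxClique G M × a ∈ M × b ∈ M)
  edge-in-maximal-clique {a} {b} a~b with maximal-extension (insert-clique (singleton-clique a) a~b′)
    where
    a~b′ : ∀ {x} → x ∈ ⁅ a ⁆ → x ≢ b → E G x b
    a~b′ x∈a _ rewrite x∈⁅y⁆⇒x≡y a x∈a = a~b
  ... | M , M-max , ab⊆M = M , M-max , ab⊆M (x∈p∪q⁺ (inj₁ (x∈⁅x⁆ a))) , ab⊆M (x∈p∪q⁺ (inj₂ (x∈⁅x⁆ b)))

module InducedPaths {n : ℕ} (G : Graph n) where
  open Cliques G using (Walk)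

  HeadAdj : Fin n → List (Fin n) → Set
  HeadAdj a [] = ⊤
  HeadAdj a (b ∷ l) = E G a b × All (λ c → ¬ E G a c) l

  InducedPath : List (Fin n) → Set
  InducedPath [] = ⊤
  InducedPath (a ∷ l) = All (a ≢_) l × HeadAdj a l × InducedPath l

  last : Fin n → List (Fin n) → Fin n
  last x [] = x
  last x (b ∷ l) = last b l

  Path : (Fin n → Set) → Fin n → Fin n → Set
  Path P x y = ∃[ l ] (InducedPath (x ∷ l) × last x l ≡ y × All P (x ∷ l))

  Touches : Fin n → Fin n → Set
  Touches x w = x ≡ w ⊎ E G x w

  touches? : ∀ x w → Dec (Touches x w)
  touches? x w = (x ≟ w) ⊎-dec dec G x w

  record LastContact (P : Fin n → Set) (x y : Fin n) : Set where
    field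
      c       : Fin n
      rest    : List (Fin n)
      path    : InducedPath (c ∷ rest)
      ends    : last c rest ≡ y
      good    : All P (c ∷ rest)
      contact : Touches x c
      later   : All (¬_ ∘ Touches x) rest

  last-contact : ∀ {P x y} c rest → InducedPath (c ∷ rest) → last c rest ≡ y → All P (c ∷ rest) →
                 Any (Touches x) (c ∷ rest) → LastContact P x y
  last-contact {x = x} c rest path ends good touching with Any.any? (touches? x) rest
  ... | no untouched = record { c = c ; rest = rest ; path = path ; ends = ends ; good = good
                              ; contact = head-contact touching ; later = ¬Any⇒All¬ rest untouched }
    where
    head-contact : Any (Touches x) (c ∷ rest) → Touches x c
    head-contact (here t) = t
    head-contact (there t) = ⊥-elim (untouched t)
  last-contact c (d ∷ rest) (_ , _ , path) ends (_ ∷ good) _ | yes touching =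
    last-contact d rest path ends good touching

  -- Every P-walk contains an induced P-path with the same ends: prepend x to the path
  -- found for the rest of the walk, cut at the last vertex touching x.
  walk⇒path : ∀ {P x y} → P x → Walk P x y → Path P x y
  walk⇒path px ε = [] , ([] , tt , tt) , refl , px ∷ []
  walk⇒path {x = x} px ((x~x′ , _ , px′) ◅ walk) with walk⇒path px′ walk
  ... | l , path , ends , good with last-contact _ l path ends good (here (inj₂ x~x′))
  ... | record { c = c ; rest = rest ; path = path′ ; ends = ends′ ; good = good′ ; contact = contact ; later = later }
      with x ≟ c
  ...   | yes refl = rest , path′ , ends′ , good′
  ...   | no x≢c = c ∷ rest
                 , (x≢c ∷ All.map (λ ¬t → ¬t ∘ inj₁) later , (adjacent contact , All.map (λ ¬t → ¬t ∘ inj₂) later) , path′)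
                 , ends′ , px ∷ good′
    where
    adjacent : Touches x c → E G x c
    adjacent (inj₁ x≡c) = ⊥-elim (x≢c x≡c)
    adjacent (inj₂ x~c) = x~c

  Consecutive : ∀ {k} → Fin k → Fin k → Set
  Consecutive i j = toℕ j ≡ suc (toℕ i) ⊎ toℕ i ≡ suc (toℕ j)

  path-injective : ∀ l → InducedPath l → ∀ i j → lookup l i ≡ lookup l j → i ≡ j
  path-injective (a ∷ l) _ zero zero _ = refl
  path-injective (a ∷ l) (a∉l , _) zero (suc j) a≡ = ⊥-elim (All.lookup a∉l (∈-lookup j) a≡)
  path-injective (a ∷ l) (a∉l , _) (suc i) zero ≡a = ⊥-elim (All.lookup a∉l (∈-lookup i) (≡.sym ≡a))
  path-injective (a ∷ l) (_ , _ , path) (suc i) (suc j) eq = ≡.cong suc (path-injective l path i j eq)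

  head-adjacent⇒first : ∀ a l → HeadAdj a l → ∀ j → E G a (lookup l j) → toℕ j ≡ 0
  head-adjacent⇒first a (b ∷ l) _ zero _ = refl
  head-adjacent⇒first a (b ∷ l) (_ , no-chord) (suc j) chord = ⊥-elim (All.lookup no-chord (∈-lookup j) chord)

  first⇒head-adjacent : ∀ a l → HeadAdj a l → ∀ j → toℕ j ≡ 0 → E G a (lookup l j)
  first⇒head-adjacent a (b ∷ l) (a~b , _) zero _ = a~b

  adjacent⇒consecutive : ∀ l → InducedPath l → ∀ i j → E G (lookup l i) (lookup l j) → Consecutive i j
  adjacent⇒consecutive (a ∷ l) _ zero zero a~a = ⊥-elim (irrefl G a~a)
  adjacent⇒consecutive (a ∷ l) (_ , head , _) zero (suc j) e = inj₁ (≡.cong suc (head-adjacent⇒first a l head j e))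
  adjacent⇒consecutive (a ∷ l) (_ , head , _) (suc i) zero e = inj₂ (≡.cong suc (head-adjacent⇒first a l head i (sym G e)))
  adjacent⇒consecutive (a ∷ l) (_ , _ , path) (suc i) (suc j) e =
    Sum.map (≡.cong suc) (≡.cong suc) (adjacent⇒consecutive l path i j e)

  consecutive⇒adjacent : ∀ l → InducedPath l → ∀ i j → Consecutive i j → E G (lookup l i) (lookup l j)
  consecutive⇒adjacent (a ∷ l) _ zero zero (inj₁ ())
  consecutive⇒adjacent (a ∷ l) _ zero zero (inj₂ ())
  consecutive⇒adjacent (a ∷ l) (_ , head , _) zero (suc j) (inj₁ j≡0) = first⇒head-adjacent a l head j (ℕ.suc-injective j≡0)
  consecutive⇒adjacent (a ∷ l) _ zero (suc j) (inj₂ ())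
  consecutive⇒adjacent (a ∷ l) _ (suc i) zero (inj₁ ())
  consecutive⇒adjacent (a ∷ l) (_ , head , _) (suc i) zero (inj₂ i≡0) = sym G (first⇒head-adjacent a l head i (ℕ.suc-injective i≡0))
  consecutive⇒adjacent (a ∷ l) (_ , _ , path) (suc i) (suc j) c =
    consecutive⇒adjacent l path i j (Sum.map ℕ.suc-injective ℕ.suc-injective c)

  last-lookup : ∀ x l → lookup (x ∷ l) (fromℕ (length l)) ≡ last x l
  last-lookup x [] = refl
  last-lookup x (b ∷ l) = last-lookup b l

  IsEnd : ∀ {k} → Fin k → Set
  IsEnd {k} i = toℕ i ≡ 0 ⊎ suc (toℕ i) ≡ k

  wrap-around : ∀ {k} t → t < k →
    (suc t < k × suc (suc t) % suc k ≡ suc (suc t)) ⊎ (suc t ≡ k × suc (suc t) % suc k ≡ 0)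
  wrap-around t t<k with ℕ.m≤n⇒m<n∨m≡n t<k
  ... | inj₁ t+1<k = inj₁ (t+1<k , m<n⇒m%n≡m (s≤s t+1<k))
  ... | inj₂ refl = inj₂ (refl , n%n≡0 (suc (suc t)))

  one-mod : ∀ k → 0 < k → 1 % suc k ≡ 1
  one-mod k 0<k = m<n⇒m%n≡m (s≤s 0<k)

  -- Closing an induced path L of length k > 0 by an outside vertex s adjacent to exactly
  -- the two ends of L: the list s ∷ L is then an induced cycle in the sense of CycAdj.
  module Closing (s : Fin n) (L : List (Fin n)) (0<k : 0 < length L) (L-path : InducedPath L)
                 (s∉L : All (s ≢_) L) (s~ends : ∀ i → E G s (lookup L i) ⇔ IsEnd i) where

    k = length L

    cycle : Fin (suc k) → Fin n
    cycle = lookup (s ∷ L)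

    cycle-injective : ∀ {i j} → cycle i ≡ cycle j → i ≡ j
    cycle-injective {zero} {zero} _ = refl
    cycle-injective {zero} {suc j} s≡ = ⊥-elim (All.lookup s∉L (∈-lookup j) s≡)
    cycle-injective {suc i} {zero} ≡s = ⊥-elim (All.lookup s∉L (∈-lookup i) (≡.sym ≡s))
    cycle-injective {suc i} {suc j} eq = ≡.cong suc (path-injective L L-path i j eq)

    end⇒apex-adjacent : ∀ j → IsEnd j → CycAdj G {k} zero (suc j)
    end⇒apex-adjacent j (inj₁ j≡0) = inj₁ (≡.trans (≡.cong suc j≡0) (≡.sym (one-mod k 0<k)))
    end⇒apex-adjacent j (inj₂ j+1≡k) with wrap-around (toℕ j) (toℕ<n j)
    ... | inj₁ (j+1<k , _) = ⊥-elim (ℕ.<-irrefl j+1≡k j+1<k)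
    ... | inj₂ (_ , wraps) = inj₂ (≡.sym wraps)

    apex-adjacent⇒end : ∀ j → CycAdj G {k} zero (suc j) → IsEnd j
    apex-adjacent⇒end j (inj₁ j+1≡1) = inj₁ (ℕ.suc-injective (≡.trans j+1≡1 (one-mod k 0<k)))
    apex-adjacent⇒end j (inj₂ 0≡) with wrap-around (toℕ j) (toℕ<n j)
    ... | inj₁ (_ , no-wrap) with ≡.trans 0≡ no-wrap
    ...   | ()
    apex-adjacent⇒end j (inj₂ 0≡) | inj₂ (j+1≡k , _) = inj₂ j+1≡k

    consecutive⇒cyclic : ∀ i j → Consecutive i j → CycAdj G {k} (suc i) (suc j)
    consecutive⇒cyclic i j (inj₁ j≡i+1) with wrap-around (toℕ i) (toℕ<n i)
    ... | inj₁ (_ , no-wrap) = inj₁ (≡.trans (≡.cong suc j≡i+1) (≡.sym no-wrap))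
    ... | inj₂ (i+1≡k , _) = ⊥-elim (ℕ.<-irrefl (≡.trans j≡i+1 i+1≡k) (toℕ<n j))
    consecutive⇒cyclic i j (inj₂ i≡j+1) with wrap-around (toℕ j) (toℕ<n j)
    ... | inj₁ (_ , no-wrap) = inj₂ (≡.trans (≡.cong suc i≡j+1) (≡.sym no-wrap))
    ... | inj₂ (j+1≡k , _) = ⊥-elim (ℕ.<-irrefl (≡.trans i≡j+1 j+1≡k) (toℕ<n i))

    cyclic⇒consecutive : ∀ i j → CycAdj G {k} (suc i) (suc j) → Consecutive i j
    cyclic⇒consecutive i j (inj₁ c) with wrap-around (toℕ i) (toℕ<n i)
    ... | inj₁ (_ , no-wrap) = inj₁ (ℕ.suc-injective (≡.trans c no-wrap))
    ... | inj₂ (_ , wraps) with ≡.trans c wraps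
    ...   | ()
    cyclic⇒consecutive i j (inj₂ c) with wrap-around (toℕ j) (toℕ<n j)
    ... | inj₁ (_ , no-wrap) = inj₂ (ℕ.suc-injective (≡.trans c no-wrap))
    ... | inj₂ (_ , wraps) with ≡.trans c wraps
    ...   | ()

    adjacent⇒cyclic : ∀ i j → E G (cycle i) (cycle j) → CycAdj G i j
    adjacent⇒cyclic zero zero s~s = ⊥-elim (irrefl G s~s)
    adjacent⇒cyclic zero (suc j) e = end⇒apex-adjacent j (Equivalence.to (s~ends j) e)
    adjacent⇒cyclic (suc i) zero e = Sum.swap (end⇒apex-adjacent i (Equivalence.to (s~ends i) (sym G e)))
    adjacent⇒cyclic (suc i) (suc j) e = consecutive⇒cyclic i j (adjacent⇒consecutive L L-path i j e)

    cyclic⇒adjacent : ∀ i j → CycAdj G i j → E G (cycle i) (cycle j)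
    cyclic⇒adjacent zero zero (inj₁ c) with ≡.trans c (one-mod k 0<k)
    ... | ()
    cyclic⇒adjacent zero zero (inj₂ c) with ≡.trans c (one-mod k 0<k)
    ... | ()
    cyclic⇒adjacent zero (suc j) c = Equivalence.from (s~ends j) (apex-adjacent⇒end j c)
    cyclic⇒adjacent (suc i) zero c = sym G (Equivalence.from (s~ends i) (apex-adjacent⇒end i (Sum.swap c)))
    cyclic⇒adjacent (suc i) (suc j) c = consecutive⇒adjacent L L-path i j (cyclic⇒consecutive i j c)

  no-closing : Chordal G → ∀ s a b c rest → InducedPath (a ∷ b ∷ c ∷ rest) → All (s ≢_) (a ∷ b ∷ c ∷ rest) →
               (∀ i → E G s (lookup (a ∷ b ∷ c ∷ rest) i) ⇔ IsEnd i) → ⊥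
  no-closing chordal s a b c rest path s∉L s~ends =
    chordal (length rest) cycle (cycle-injective , λ i j → mk⇔ (adjacent⇒cyclic i j) (cyclic⇒adjacent i j))
    where open Closing s (a ∷ b ∷ c ∷ rest) (s≤s z≤n) path s∉L s~ends

module NeighbourhoodWalks {n : ℕ} {G : Graph n} (chordal : Chordal G) where
  open Cliques G using (Walk)
  open InducedPaths G

  module AroundVertex {P : Fin n → Set} (s : Fin n) (s∉P : ∀ {w} → P w → s ≢ w) where

    Step : Fin n → Fin n → Set
    Step p q = E G p q × P p × P q

    Detour : Fin n → Fin n → Set
    Detour = Star (λ p q → Step p q × ¬ E G s q)

    Between : Fin n → Fin n → Fin n → Set
    Between a b w = P w × (w ≡ a ⊎ w ≡ b ⊎ ¬ E G s w)

    detour⇒walk : ∀ {a b p c} → Between a b p → Detour p c → Step c b → Walk (Between a b) p b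
    detour⇒walk p-between ε (c~b , _ , pb) = (c~b , p-between , pb , inj₂ (inj₁ refl)) ◅ ε
    detour⇒walk p-between (((p~q , _ , pq) , s≁q) ◅ rest) final =
      (p~q , p-between , q-between) ◅ detour⇒walk q-between rest final
      where
      q-between : Between _ _ _
      q-between = pq , inj₂ (inj₂ s≁q)

    sees-ends : ∀ {a b} → E G s a → E G s b → ∀ l → InducedPath (a ∷ l) → last a l ≡ b →
                All (Between a b) (a ∷ l) → ∀ i → E G s (lookup (a ∷ l) i) ⇔ IsEnd i
    sees-ends {a} {b} s~a s~b l path ends between i = mk⇔ to from
      where
      final : Fin (length (a ∷ l))
      final = fromℕ (length l)
      final≡b : lookup (a ∷ l) final ≡ b
      final≡b = ≡.trans (last-lookup a l) ends
      to : E G s (lookup (a ∷ l) i) → IsEnd i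
      to s~ with proj₂ (All.lookup between (∈-lookup i))
      ... | inj₁ ≡a = inj₁ (≡.cong toℕ (path-injective (a ∷ l) path i zero ≡a))
      ... | inj₂ (inj₁ ≡b) = inj₂ (≡.cong suc (begin
            toℕ i     ≡⟨ ≡.cong toℕ (path-injective (a ∷ l) path i final (≡.trans ≡b (≡.sym final≡b))) ⟩
            toℕ final ≡⟨ toℕ-fromℕ (length l) ⟩
            length l  ∎))
      ... | inj₂ (inj₂ s≁) = ⊥-elim (s≁ s~)
      from : IsEnd i → E G s (lookup (a ∷ l) i)
      from (inj₁ i≡0) with toℕ-injective {i = i} {j = zero} i≡0
      ... | refl = s~a
      from (inj₂ i+1≡k) with toℕ-injective {i = i} {j = final} (≡.trans (ℕ.suc-injective i+1≡k) (≡.sym (toℕ-fromℕ (length l))))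
      ... | refl = ≡.subst (E G s) (≡.sym final≡b) s~b

    no-induced-path : ∀ {a b} → E G s a → E G s b → a ≢ b → ¬ E G a b → ∀ l → InducedPath (a ∷ l) →
                      last a l ≡ b → All (Between a b) (a ∷ l) → ⊥
    no-induced-path _ _ a≢b _ [] _ ends _ = a≢b ends
    no-induced-path {a} _ _ _ a≁b (c ∷ []) (_ , (a~c , _) , _) ends _ = a≁b (≡.subst (E G a) ends a~c)
    no-induced-path s~a s~b _ _ (c ∷ d ∷ rest) path ends between =
      no-closing chordal s _ c d rest path (All.map (s∉P ∘ proj₁) between)
                 (sees-ends s~a s~b (c ∷ d ∷ rest) path ends between)

    shortcut : ∀ {a c b} → P a → E G s a → E G s b → Detour a c → Step c b → a ≡ b ⊎ E G a b
    shortcut {a} {b = b} pa s~a s~b detour step with a ≟ b | dec G a b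
    ... | yes a≡b | _ = inj₁ a≡b
    ... | no _ | yes a~b = inj₂ a~b
    ... | no a≢b | no a≁b with walk⇒path (pa , inj₁ refl) (detour⇒walk (pa , inj₁ refl) detour step)
    ...   | l , path , ends , between = ⊥-elim (no-induced-path s~a s~b a≢b a≁b l path ends between)

    detour-end : ∀ {a c} → Detour a c → a ≡ c ⊎ ¬ E G s c
    detour-end ε = inj₁ refl
    detour-end (step ◅ rest) = inj₂ (nonempty-end step rest)
      where
      nonempty-end : ∀ {x y z} → Step x y × ¬ E G s y → Detour y z → ¬ E G s z
      nonempty-end (_ , s≁y) ε = s≁y
      nonempty-end _ (step′ ◅ rest′) = nonempty-end step′ rest′

    -- Scan a P-walk, remembering the last neighbour a of s visited and the detour taken since.
    scan : ∀ {a c b} → P a → E G s a → Detour a c → Walk P c b → P b → E G s b →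
           Walk (λ w → P w × E G s w) a b
    scan _ _ detour ε _ s~b with detour-end detour
    ... | inj₁ refl = ε
    ... | inj₂ s≁b = ⊥-elim (s≁b s~b)
    scan pa s~a detour (_◅_ {j = d} step rest) pb s~b with dec G s d
    ... | no s≁d = scan pa s~a (detour ◅◅ ((step , s≁d) ◅ ε)) rest pb s~b
    ... | yes s~d with shortcut pa s~a s~d detour step
    ...   | inj₁ refl = scan pa s~a ε rest pb s~b
    ...   | inj₂ a~d = (a~d , (pa , s~a) , (pd , s~d)) ◅ scan pd s~d ε rest pb s~b
      where
      pd : P d
      pd = proj₂ (proj₂ step)

    neighbourhood-walk : ∀ {a b} → P a → P b → E G s a → E G s b → Walk P a b →
                         Walk (λ w → P w × E G s w) a b
    neighbourhood-walk pa pb s~a s~b walk = scan pa s~a ε walk pb s~b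

  open AroundVertex using (neighbourhood-walk)

  common-neighbourhood-walk : ∀ {P x y} Ls → All (λ s → ¬ P s × E G s x × E G s y) Ls → P x → P y →
    Walk P x y → Walk (λ w → P w × All (λ s → E G s w) Ls) x y
  common-neighbourhood-walk [] _ px py walk = Star.map (λ { (e , p , q) → e , (p , []) , (q , []) }) walk
  common-neighbourhood-walk {P} (s ∷ Ls) ((¬ps , s~x , s~y) ∷ hyps) px py walk =
    Star.map (λ { (e , ((p , Ls~p) , s~p) , ((q , Ls~q) , s~q)) → e , (p , s~p ∷ Ls~p) , (q , s~q ∷ Ls~q) })
      (neighbourhood-walk s (λ { (pw , _) s≡w → ¬ps (≡.subst P (≡.sym s≡w) pw) })
        (px , All.map (proj₁ ∘ proj₂) hyps) (py , All.map (proj₂ ∘ proj₂) hyps) s~x s~y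
        (common-neighbourhood-walk Ls hyps px py walk))

module CliqueGraph {n : ℕ} {G : Graph n} (chordal : Chordal G) where
  open Cliques G
  open NeighbourhoodWalks {G = G} chordal using (common-neighbourhood-walk)

  CompleteTo : Subset n → Fin n → Set
  CompleteTo T w = w ∉ T × (∀ {t} → t ∈ T → E G t w)

  clique-complete : ∀ {K T w} → IsClique G K → T ⊆ K → w ∈ K → w ∉ T → CompleteTo T w
  clique-complete K-clique T⊆K w∈K w∉T =
    w∉T , λ t∈T → K-clique (T⊆K t∈T) w∈K λ t≡w → w∉T (≡.subst (_∈ _) t≡w t∈T)

  -- Key consequence of chordality: a walk avoiding T between two vertices complete to T can
  -- be rerouted through vertices complete to T (reroute around each t ∈ T in turn).
  complete-walk : ∀ {T x y} → CompleteTo T x → CompleteTo T y → Walk (_∉ T) x y → Walk (CompleteTo T) x y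
  complete-walk {T} {x} {y} (x∉T , T~x) (y∉T , T~y) walk =
    Star.map (λ { (e , p , q) → e , complete p , complete q })
      (common-neighbourhood-walk Ts (All.tabulate around) x∉T y∉T walk)
    where
    Ts : List (Fin n)
    Ts = filter (_∈? T) (allFin n)
    around : ∀ {t} → t ∈ₗ Ts → ¬ (t ∉ T) × E G t x × E G t y
    around t∈Ts = let t∈T = proj₂ (∈-filter⁻ (_∈? T) {xs = allFin n} t∈Ts) in (λ t∉T → t∉T t∈T) , T~x t∈T , T~y t∈T
    complete : ∀ {w} → w ∉ T × All (λ t → E G t w) Ts → CompleteTo T w
    complete (w∉T , Ts~w) = w∉T , λ t∈T → All.lookup Ts~w (∈-filter⁺ (_∈? T) (∈-allFin _) t∈T)

  Above : Subset n → Subset n → Subset n → Set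
  Above T A B = IsMaxClique G A × IsMaxClique G B × (A ∩ B) ⊃ T

  Covers : Subset n → Fin n → Subset n → Set
  Covers T w A = IsMaxClique G A × T ⊆ A × w ∈ A

  covers-above : ∀ {T w A B} → w ∉ T → Covers T w A → Covers T w B → Above T A B
  covers-above w∉T (A-max , T⊆A , w∈A) (B-max , T⊆B , w∈B) =
    A-max , B-max , (λ t∈T → x∈p∩q⁺ (T⊆A t∈T , T⊆B t∈T)) , _ , x∈p∩q⁺ (w∈A , w∈B) , w∉T

  edge-cover : ∀ {T w w′} → IsClique G T → CompleteTo T w → CompleteTo T w′ → E G w w′ →
               ∃[ C ] (Covers T w C × Covers T w′ C)
  edge-cover {T} {w} {w′} T-clique (_ , T~w) (_ , T~w′) w~w′ with maximal-extension T+w+w′-clique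
    where
    T+w-clique : IsClique G (T ∪ ⁅ w ⁆)
    T+w-clique = insert-clique T-clique λ t∈T _ → T~w t∈T
    to-w′ : ∀ {x} → x ∈ T ∪ ⁅ w ⁆ → x ≢ w′ → E G x w′
    to-w′ x∈ _ with x∈p∪q⁻ T ⁅ w ⁆ x∈
    ... | inj₁ x∈T = T~w′ x∈T
    ... | inj₂ x∈w rewrite x∈⁅y⁆⇒x≡y w x∈w = w~w′
    T+w+w′-clique : IsClique G ((T ∪ ⁅ w ⁆) ∪ ⁅ w′ ⁆)
    T+w+w′-clique = insert-clique T+w-clique to-w′
  ... | C , C-max , ⊆C = C , (C-max , T⊆C , w∈C) , (C-max , T⊆C , w′∈C)
    where
    T⊆C : T ⊆ C
    T⊆C t∈T = ⊆C (x∈p∪q⁺ (inj₁ (x∈p∪q⁺ (inj₁ t∈T))))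
    w∈C : w ∈ C
    w∈C = ⊆C (x∈p∪q⁺ (inj₁ (x∈p∪q⁺ (inj₂ (x∈⁅x⁆ w)))))
    w′∈C : w′ ∈ C
    w′∈C = ⊆C (x∈p∪q⁺ (inj₂ (x∈⁅x⁆ w′)))

  walk⇒chain : ∀ {T w y A B} → IsClique G T → CompleteTo T w → Covers T w A →
               Walk (CompleteTo T) w y → Covers T y B → Star (Above T) A B
  walk⇒chain _ (w∉T , _) A-covers ε B-covers = covers-above w∉T A-covers B-covers ◅ ε
  walk⇒chain T-clique (w∉T , T~w) A-covers ((w~w′ , _ , w′-complete) ◅ walk) B-covers
    with edge-cover T-clique (w∉T , T~w) w′-complete w~w′
  ... | C , w-in-C , w′-in-C =
    covers-above w∉T A-covers w-in-C ◅ walk⇒chain T-clique w′-complete w′-in-C walk B-covers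

  -- If every vertex of T is adjacent to both x and y and T separates x from y, then T is a
  -- minimal x–y separator: without t ∈ T the path x–t–y reconnects x and y.
  common-neighbours-minimal : ∀ {x y T} → (∀ {t} → t ∈ T → E G x t × E G t y) →
                              SepUV G x y T → MinSepUV G x y T
  common-neighbours-minimal {x} {y} {T} T~xy separates = separates , minimal
    where
    minimal : ∀ T′ → T′ ⊆ T → SepUV G x y T′ → T ⊆ T′
    minimal T′ _ (x∉T′ , y∉T′ , T′-separates) {t} t∈T = decidable-stable (t ∈? T′) λ t∉T′ →
      T′-separates (x∉T′ , (proj₁ (T~xy t∈T) , x∉T′ , t∉T′) ◅ (proj₂ (T~xy t∈T) , t∉T′ , y∉T′) ◅ ε)

  module _ {K₁ K₂ : Subset n} (K₁-max : IsMaxClique G K₁) (K₂-max : IsMaxClique G K₂) where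

    private
      T : Subset n
      T = K₁ ∩ K₂

      T⊆K₁ : T ⊆ K₁
      T⊆K₁ = p∩q⊆p K₁ K₂

      T⊆K₂ : T ⊆ K₂
      T⊆K₂ = p∩q⊆q K₁ K₂

      Crossing : Fin n → Fin n → Set
      Crossing x y = x ∈ K₁ × x ∉ K₂ × y ∈ K₂ × y ∉ K₁ × Walk (_∉ T) x y

      crossing? : ∀ x y → Dec (Crossing x y)
      crossing? x y = (x ∈? K₁) ×-dec ¬? (x ∈? K₂) ×-dec (y ∈? K₂) ×-dec ¬? (y ∈? K₁) ×-dec
                      Reachability.star? (λ a b → dec G a b ×-dec ¬? (a ∈? T) ×-dec ¬? (b ∈? T)) x y

    adjacent-or-chain : K₁ ≢ K₂ → CAdj G K₁ K₂ ⊎ Star (Above T) K₁ K₂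
    adjacent-or-chain K₁≢K₂ with any? (λ x → any? (crossing? x))
    ... | yes (x , y , x∈K₁ , x∉K₂ , y∈K₂ , y∉K₁ , x⇝y) =
      inj₂ (walk⇒chain (subset-clique (proj₁ K₁-max) T⊆K₁) x-complete (K₁-max , T⊆K₁ , x∈K₁)
              (complete-walk x-complete y-complete x⇝y) (K₂-max , T⊆K₂ , y∈K₂))
      where
      x-complete : CompleteTo T x
      x-complete = clique-complete (proj₁ K₁-max) T⊆K₁ x∈K₁ (x∉K₂ ∘ T⊆K₂)
      y-complete : CompleteTo T y
      y-complete = clique-complete (proj₁ K₂-max) T⊆K₂ y∈K₂ (y∉K₁ ∘ T⊆K₁)
    ... | no none = inj₁ (K₁-max , K₂-max , K₁≢K₂ , minimal-separator)
      where
      minimal-separator : ∀ x y → x ∈ K₁ → x ∉ K₂ → y ∈ K₂ → y ∉ K₁ → MinSepUV G x y T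
      minimal-separator x y x∈K₁ x∉K₂ y∈K₂ y∉K₁ =
        common-neighbours-minimal (λ t∈T → sym G (proj₂ x-complete t∈T) , proj₂ y-complete t∈T)
          (proj₁ x-complete , proj₁ y-complete ,
           λ { (_ , x⇝y) → none (x , y , x∈K₁ , x∉K₂ , y∈K₂ , y∉K₁ , x⇝y) })
        where
        x-complete : CompleteTo T x
        x-complete = clique-complete (proj₁ K₁-max) T⊆K₁ x∈K₁ (x∉K₂ ∘ T⊆K₂)
        y-complete : CompleteTo T y
        y-complete = clique-complete (proj₁ K₂-max) T⊆K₂ y∈K₂ (y∉K₁ ∘ T⊆K₁)

  ThroughVertex : Subset n → Fin n → Subset n → Subset n → Set
  ThroughVertex S v A B = CAdjMinus G S A B × v ∈ A × v ∈ B

  -- Part one, by well-founded induction on K₁ ∩ K₂ along ⊃: either K₁K₂ is an edge of C(G)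
  -- whose label contains v ∉ S, or the chain above K₁ ∩ K₂ consists of pairs of cliques
  -- with larger intersections, which still contain v.
  through-vertex-connected : ∀ {S v K₁ K₂} → v ∉ S → Acc _⊃_ (K₁ ∩ K₂) →
    IsMaxClique G K₁ → IsMaxClique G K₂ → v ∈ K₁ → v ∈ K₂ → Star (ThroughVertex S v) K₁ K₂
  through-vertex-connected {K₁ = K₁} {K₂} v∉S (acc larger) K₁-max K₂-max v∈K₁ v∈K₂ with K₁ ≟ₛ K₂
  ... | yes refl = ε
  ... | no K₁≢K₂ with adjacent-or-chain K₁-max K₂-max K₁≢K₂
  ...   | inj₁ K₁K₂ = ((K₁K₂ , λ T⊆S → v∉S (T⊆S (x∈p∩q⁺ (v∈K₁ , v∈K₂)))) , v∈K₁ , v∈K₂) ◅ ε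
  ...   | inj₂ chain = follow chain
    where
    follow : ∀ {A B} → Star (Above (K₁ ∩ K₂)) A B → Star (ThroughVertex _ _) A B
    follow ε = ε
    follow (_◅_ {i = A} {j = B} (A-max , B-max , T⊂A∩B) rest) =
      through-vertex-connected v∉S (larger T⊂A∩B) A-max B-max (p∩q⊆p _ _ v∈A∩B) (p∩q⊆q _ _ v∈A∩B)
        ◅◅ follow rest
      where
      v∈A∩B : _ ∈ A ∩ B
      v∈A∩B = proj₁ T⊂A∩B (x∈p∩q⁺ (v∈K₁ , v∈K₂))

  -- A path in C(G) - S between cliques containing a, b ∉ S yields a walk in G - S: the label
  -- of each edge is not contained in S, so both cliques share a vertex outside S.
  clique-path⇒walk : ∀ {S K₁ K₂ a b} → IsClique G K₁ → Star (CAdjMinus G S) K₁ K₂ →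
                     a ∈ K₁ → a ∉ S → b ∈ K₂ → b ∉ S → Walk (_∉ S) a b
  clique-path⇒walk K₁-clique ε a∈K₁ a∉S b∈K₂ b∉S = clique-walk K₁-clique a∈K₁ b∈K₂ a∉S b∉S
  clique-path⇒walk K₁-clique (((_ , K′-max , _) , label⊈S) ◅ path) a∈K₁ a∉S b∈K₂ b∉S
    with ⊈-witness label⊈S
  ... | w , w∈label , w∉S =
    clique-walk K₁-clique a∈K₁ (p∩q⊆p _ _ w∈label) a∉S w∉S
      ◅◅ clique-path⇒walk (proj₁ K′-max) path (p∩q⊆q _ _ w∈label) w∉S b∈K₂ b∉S

  -- Conversely a walk in G - S from a ∈ K yields a path in C(G) - S from K to a maximal clique
  -- containing the end: each edge lies in a maximal clique, reached by part one.
  walk⇒clique-path : ∀ {S a b K} → Walk (_∉ S) a b → IsMaxClique G K → a ∈ K →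
                     ∃[ K′ ] (IsMaxClique G K′ × b ∈ K′ × Star (CAdjMinus G S) K K′)
  walk⇒clique-path ε K-max a∈K = _ , K-max , a∈K , ε
  walk⇒clique-path ((a~a′ , a∉S , _) ◅ walk) K-max a∈K with edge-in-maximal-clique a~a′
  ... | M , M-max , a∈M , a′∈M with walk⇒clique-path walk M-max a′∈M
  ...   | K′ , K′-max , b∈K′ , M⇝K′ =
    K′ , K′-max , b∈K′ ,
    (Star.map proj₁ (through-vertex-connected a∉S (⊃-wellFounded _) K-max M-max a∈K a∈M) ◅◅ M⇝K′)

  Linked : Subset n → Fin n → Fin n → Set
  Linked S u v = ∃[ K₁ ] ∃[ K₂ ] (IsMaxClique G K₁ × IsMaxClique G K₂ × u ∈ K₁ × v ∈ K₂ × CPath G S K₁ K₂)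

  linked⇔reachable : ∀ {S u v} → u ∉ S → v ∉ S → Linked S u v ⇔ ReachAvoid G S u v
  linked⇔reachable {u = u} u∉S v∉S = mk⇔ to from
    where
    to : Linked _ _ _ → ReachAvoid G _ _ _
    to (_ , _ , K₁-max , _ , u∈K₁ , v∈K₂ , _ , path) =
      u∉S , clique-path⇒walk (proj₁ K₁-max) path u∈K₁ u∉S v∈K₂ v∉S
    from : ReachAvoid G _ _ _ → Linked _ _ _
    from (_ , u⇝v) with maximal-extension (singleton-clique u)
    ... | K , K-max , u⊆K with walk⇒clique-path u⇝v K-max (u⊆K (x∈⁅x⁆ u))
    ...   | K′ , K′-max , v∈K′ , path = K , K′ , K-max , K′-max , u⊆K (x∈⁅x⁆ u) , v∈K′ , K-max , path

proposition8 : ∀ {n} (G : Graph n) (S : Subset n) →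
    Chordal G → IsSeparator G S →
    (∀ v → v ∉ S → ∀ K₁ K₂ → IsMaxClique G K₁ → IsMaxClique G K₂ →
      v ∈ K₁ → v ∈ K₂ → CPathThrough G S v K₁ K₂)
    ×
    (∀ u v → u ≢ v → u ∉ S → v ∉ S →
      (¬ (∃[ K₁ ] ∃[ K₂ ] (IsMaxClique G K₁ × IsMaxClique G K₂ × u ∈ K₁ × v ∈ K₂ × CPath G S K₁ K₂)))
        ⇔ SepUV G u v S)
proposition8 G S chordal _ =
  (λ v v∉S K₁ K₂ K₁-max K₂-max v∈K₁ v∈K₂ →
    K₁-max , v∈K₁ , through-vertex-connected v∉S (⊃-wellFounded _) K₁-max K₂-max v∈K₁ v∈K₂) ,
  (λ u v _ u∉S v∉S → let open Equivalence (linked⇔reachable u∉S v∉S) in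
    mk⇔ (λ unlinked → u∉S , v∉S , unlinked ∘ from) (λ { (_ , _ , unreachable) → unreachable ∘ to }))
  where open CliqueGraph {G = G} chordal
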